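{- Let $m\geq 2$. There exists a signature $E_-\subseteq E(P_{2m+1,2})$ such that the frustration index of the signed graph $(P_{2m+1,2},E_-)$ equals $m+1$.
   Context: For positive integers $n,k$ with $2\le 2k<n$, the generalised Petersen graph $P_{n,k}$ has vertex set $\{u_i,v_i: i\in\{0,\dots,n-1\}\}$ and edge set $\{u_iu_{i+1}, v_iv_{i+k}, u_iv_i : i\in\{0,\dots,n-1\}\}$, indices modulo $n$. A signed graph $(G,E_-)$ is a simple graph $G$ with a set $E_-\subseteq E(G)$ of negative edges; other edges are positive. A cycle is positive if the product of its edge signs is positive; a signed graph is balanced if every cycle is positive. The frustration index of $(G,E_-)$ is the minimum number of edges whose deletion leaves a balanced signed graph. -}

module Defs where

open import Data.Nat using (ℕ; suc; _+_; _*_; _≤_)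
open import Data.Nat.DivMod using (_mod_; _%_)
open import Data.Fin using (Fin; toℕ)
open import Data.Bool using (Bool; true; false)
open import Data.List using (List; _∷_; []; map; concatMap; filterᵇ; length; allFin)
open import Data.Product using (_×_; _,_; Σ; ∃)
open import Data.Sum using (_⊎_)
open import Function.Definitions using (Injective)
open import Relation.Binary.PropositionalEquality using (_≡_)

-- Generalised Petersen graph P_{n,k}, with n = suc n' (so indices mod n make sense).
data Side : Set where
  outer inner : Side          -- outer = u_i, inner = v_i

Vertex : ℕ → Set
Vertex n = Side × Fin n

data EKind : Set where
  rim spoke inn : EKind       -- u_i u_{i+1},  u_i v_i,  v_i v_{i+k}

-- Edge (κ , i) is the edge of kind κ with index i; for 2 ≤ 2k < n these 3n edges are distinct.
Edge : ℕ → Set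
Edge n = EKind × Fin n

shift : ∀ {n'} → Fin (suc n') → ℕ → Fin (suc n')
shift {n'} i j = (toℕ i + j) mod (suc n')

ends : ∀ n' (k : ℕ) → Edge (suc n') → Vertex (suc n') × Vertex (suc n')
ends n' k (rim   , i) = (outer , i) , (outer , shift i 1)
ends n' k (spoke , i) = (outer , i) , (inner , i)
ends n' k (inn   , i) = (inner , i) , (inner , shift i k)

Joins : ∀ n' k → Edge (suc n') → Vertex (suc n') → Vertex (suc n') → Set
Joins n' k e x y = ends n' k e ≡ (x , y) ⊎ ends n' k e ≡ (y , x)

allEdges : ∀ n → List (Edge n)
allEdges n = concatMap (λ κ → map (κ ,_) (allFin n)) (rim ∷ spoke ∷ inn ∷ [])

-- a set of edges is given by its characteristic function; its cardinality:
card : ∀ {n} → (Edge n → Bool) → ℕ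
card {n} D = length (filterᵇ D (allEdges n))

-- A cycle of length 3 + len in P_{suc n', k} minus the edge set D:
-- distinct vertices x_0 … x_{ℓ-1}, with edge e_i joining x_i and x_{i+1 mod ℓ}, e_i ∉ D.
record Cycle (n' k : ℕ) (D : Edge (suc n') → Bool) : Set where
  field
    len   : ℕ
    vtx   : Fin (3 + len) → Vertex (suc n')
    edg   : Fin (3 + len) → Edge (suc n')
    vtx-injective : Injective _≡_ _≡_ vtx
    edg-joins : ∀ i → Joins n' k (edg i) (vtx i) (vtx ((suc (toℕ i)) mod (3 + len)))
    edg-kept  : ∀ i → D (edg i) ≡ false

-- the cycle is positive w.r.t. the negative edge set σ: even number of negative edges
Positive : ∀ {n' k D} → (σ : Edge (suc n') → Bool) → Cycle n' k D → Set
Positive σ C = length (filterᵇ (λ i → σ (edg i)) (allFin (3 + len))) % 2 ≡ 0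
  where open Cycle C

Balanced : ∀ n' k → (σ D : Edge (suc n') → Bool) → Set
Balanced n' k σ D = (C : Cycle n' k D) → Positive σ C

FrustrationIndexIs : ∀ n' k → (σ : Edge (suc n') → Bool) → ℕ → Set
FrustrationIndexIs n' k σ r =
  (Σ (Edge (suc n') → Bool) λ D → card D ≡ r × Balanced n' k σ D)
  × (∀ (D : Edge (suc n') → Bool) → Balanced n' k σ D → r ≤ card D)

module Submission where

-- Frustration index of P_{2m+1,2} (m ≥ 2): the signature σ making the rim
-- edges u_i u_{i+1} with i odd and the inner edge v_{2m} v_1 negative has
-- frustration index exactly m + 1.
--
-- Upper bound: deleting the m + 1 negative edges of any signature leaves only
-- positive edges, hence a balanced graph.
-- Lower bound: for every j the pentagon u_j u_{j+1} u_{j+2} v_{j+2} v_j of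
-- P_{n,2} (n ≥ 3) contains exactly one σ-negative edge, so a balancing set D
-- must hit each of the n pentagons.  Every rim edge and every spoke lies on
-- two pentagons and every inner edge on one, so double counting gives
-- n ≤ 2 |D|; with n = 2m + 1 this is |D| ≥ m + 1.

open import Defs
open import Data.Nat using (ℕ; zero; suc; _+_; _*_; _≤_; _<_; _∸_; z≤n; s≤s; z<s; _%_; _≡ᵇ_; _<?_)
open import Data.Nat.Properties
open import Data.Nat.DivMod
open import Data.Nat.Solver using (module +-*-Solver)
open import Data.Fin using (Fin; toℕ) renaming (zero to fz; suc to fs)
open import Data.Fin.Properties using (toℕ-injective; toℕ-fromℕ<; toℕ<n)
open import Data.Bool using (Bool; true; false; not; T; T?)
open import Data.List using (List; _∷_; []; map; filterᵇ; length; allFin; _++_; tabulate)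
open import Data.List.Properties using (map-tabulate; filter-++; filter-none; length-++; ++-identityʳ)
open import Data.List.Membership.Propositional using (_∈_)
open import Data.List.Membership.Propositional.Properties using (∈-allFin)
open import Data.List.Relation.Unary.All using (universal)
open import Data.List.Relation.Unary.Any using (here; there)
open import Data.Product using (Σ; _×_; _,_; proj₁; proj₂)
open import Data.Sum using (inj₁; inj₂)
open import Data.Empty using (⊥-elim)
open import Function using (_∘_; id)
open import Relation.Binary.Definitions using (tri<; tri≈; tri>)
open import Relation.Binary.PropositionalEquality
open import Relation.Nullary using (¬_; yes; no)
open +-*-Solver using (solve; _:+_; _:*_; _:=_; con)

bit : Bool → ℕ
bit true = 1
bit false = 0

bit-T : ∀ {b} → T b → bit b ≡ 1
bit-T {true} _ = refl

bit-¬T : ∀ {b} → ¬ T b → bit b ≡ 0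
bit-¬T {true} ¬t = ⊥-elim (¬t _)
bit-¬T {false} _ = refl

bit-zero : ∀ {b} → bit b ≡ 0 → b ≡ false
bit-zero {false} _ = refl

bit-not : ∀ b → bit b + bit (not b) ≡ 1
bit-not true = refl
bit-not false = refl

count : ∀ {A : Set} → (A → Bool) → List A → ℕ
count p xs = length (filterᵇ p xs)

count-∷ : ∀ {A : Set} (p : A → Bool) x xs → count p (x ∷ xs) ≡ bit (p x) + count p xs
count-∷ p x xs with p x
... | true = refl
... | false = refl

count-++ : ∀ {A : Set} (p : A → Bool) xs ys → count p (xs ++ ys) ≡ count p xs + count p ys
count-++ p xs ys = trans (cong length (filter-++ (T? ∘ p) xs ys)) (length-++ (filterᵇ p xs))

count-none : ∀ {A : Set} (p : A → Bool) xs → (∀ x → p x ≡ false) → count p xs ≡ 0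
count-none p xs rejected = cong length (filter-none (T? ∘ p) (universal (λ x → subst T (rejected x)) xs))

count-zero : ∀ {A : Set} (p : A → Bool) {x} xs → count p xs ≡ 0 → x ∈ xs → p x ≡ false
count-zero p (y ∷ ys) none (here refl) = bit-zero (m+n≡0⇒m≡0 (bit (p y)) (trans (sym (count-∷ p y ys)) none))
count-zero p (y ∷ ys) none (there x∈ys) = count-zero p ys (m+n≡0⇒n≡0 (bit (p y)) (trans (sym (count-∷ p y ys)) none)) x∈ys

sumBelow : ℕ → (ℕ → ℕ) → ℕ
sumBelow zero f = 0
sumBelow (suc n) f = sumBelow n f + f n

sumBelow-cong : ∀ n (f g : ℕ → ℕ) → (∀ j → j < n → f j ≡ g j) → sumBelow n f ≡ sumBelow n g
sumBelow-cong zero f g _ = refl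
sumBelow-cong (suc n) f g f≡g = cong₂ _+_ (sumBelow-cong n f g (λ j j<n → f≡g j (m<n⇒m<1+n j<n))) (f≡g n (n<1+n n))

sumBelow-zero : ∀ n → sumBelow n (λ _ → 0) ≡ 0
sumBelow-zero zero = refl
sumBelow-zero (suc n) = cong (_+ 0) (sumBelow-zero n)

sumBelow-+ : ∀ n (f g : ℕ → ℕ) → sumBelow n (λ j → f j + g j) ≡ sumBelow n f + sumBelow n g
sumBelow-+ zero f g = refl
sumBelow-+ (suc n) f g = trans (cong (_+ (f n + g n)) (sumBelow-+ n f g)) (interchange (sumBelow n f) (sumBelow n g) (f n) (g n))
  where
  interchange : ∀ a b c d → a + b + (c + d) ≡ a + c + (b + d)
  interchange = solve 4 (λ a b c d → a :+ b :+ (c :+ d) := a :+ c :+ (b :+ d)) refl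

sumBelow-unfoldˡ : ∀ n (f : ℕ → ℕ) → sumBelow (suc n) f ≡ f 0 + sumBelow n (f ∘ suc)
sumBelow-unfoldˡ zero f = +-comm 0 (f 0)
sumBelow-unfoldˡ (suc n) f = trans (cong (_+ f (suc n)) (sumBelow-unfoldˡ n f)) (+-assoc (f 0) _ _)

sumBelow-≥ : ∀ n (f : ℕ → ℕ) → (∀ j → j < n → 1 ≤ f j) → n ≤ sumBelow n f
sumBelow-≥ zero f _ = z≤n
sumBelow-≥ (suc n) f positive =
  subst (_≤ sumBelow n f + f n) (+-comm n 1)
    (+-mono-≤ (sumBelow-≥ n f (λ j j<n → positive j (m<n⇒m<1+n j<n))) (positive n (n<1+n n)))

sumBelow-rotate : ∀ n (f : ℕ → ℕ) → f n ≡ f 0 → sumBelow n (f ∘ suc) ≡ sumBelow n f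
sumBelow-rotate n f periodic = +-cancelʳ-≡ (f 0) _ _ (begin
    sumBelow n (f ∘ suc) + f 0  ≡⟨ +-comm _ (f 0) ⟩
    f 0 + sumBelow n (f ∘ suc)  ≡⟨ sumBelow-unfoldˡ n f ⟨
    sumBelow n f + f n          ≡⟨ cong (sumBelow n f +_) periodic ⟩
    sumBelow n f + f 0          ∎)
  where open ≡-Reasoning

count-tabulate : ∀ {A : Set} n (g : Fin n → A) (p : A → Bool) (f : ℕ → ℕ) →
  (∀ i → bit (p (g i)) ≡ f (toℕ i)) → count p (tabulate g) ≡ sumBelow n f
count-tabulate zero g p f _ = refl
count-tabulate (suc n) g p f indicator = begin
    count p (tabulate g)                          ≡⟨ count-∷ p (g fz) _ ⟩
    bit (p (g fz)) + count p (tabulate (g ∘ fs))  ≡⟨ cong₂ _+_ (indicator fz) (count-tabulate n (g ∘ fs) p (f ∘ suc) (indicator ∘ fs)) ⟩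
    f 0 + sumBelow n (f ∘ suc)                    ≡⟨ sumBelow-unfoldˡ n f ⟨
    sumBelow (suc n) f                            ∎
  where open ≡-Reasoning

module Residues (n' : ℕ) where
  N : ℕ
  N = suc n'

  toℕ-mod : ∀ a → toℕ (a mod N) ≡ a % N
  toℕ-mod a = toℕ-fromℕ< _

  toℕ-mod-below : ∀ {a} → a < N → toℕ (a mod N) ≡ a
  toℕ-mod-below {a} a<N = trans (toℕ-mod a) (m<n⇒m%n≡m a<N)

  mod-≡ : ∀ a b → a % N ≡ b % N → a mod N ≡ b mod N
  mod-≡ a b eq = toℕ-injective (trans (toℕ-mod a) (trans eq (sym (toℕ-mod b))))

  fin-mod : (i : Fin N) → toℕ i mod N ≡ i
  fin-mod i = toℕ-injective (toℕ-mod-below (toℕ<n i))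

  mod-period : ∀ a → (a + N) mod N ≡ a mod N
  mod-period a = mod-≡ (a + N) a ([m+n]%n≡m%n a N)

  %-absorbʳ : ∀ k a → (k + a % N) % N ≡ (k + a) % N
  %-absorbʳ k a = begin
    (k + a % N) % N          ≡⟨ %-distribˡ-+ k (a % N) N ⟩
    (k % N + a % N % N) % N  ≡⟨ cong (λ r → (k % N + r) % N) (m%n%n≡m%n a N) ⟩
    (k % N + a % N) % N      ≡⟨ %-distribˡ-+ k a N ⟨
    (k + a) % N              ∎
    where open ≡-Reasoning

  shift-mod : ∀ a k → shift (a mod N) k ≡ (k + a) mod N
  shift-mod a k = mod-≡ (toℕ (a mod N) + k) (k + a) (begin
    (toℕ (a mod N) + k) % N  ≡⟨ cong (λ r → (r + k) % N) (toℕ-mod a) ⟩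
    (a % N + k) % N          ≡⟨ cong (_% N) (+-comm (a % N) k) ⟩
    (k + a % N) % N          ≡⟨ %-absorbʳ k a ⟩
    (k + a) % N              ∎)
    where open ≡-Reasoning

  shift-≢ : ∀ {k} a → 0 < k → k < N → (k + a) mod N ≢ a mod N
  shift-≢ {k} a 0<k k<N fixed = moves (a % N) (m%n<n a N) (begin
      (k + a % N) % N  ≡⟨ %-absorbʳ k a ⟩
      (k + a) % N      ≡⟨ toℕ-mod (k + a) ⟨
      toℕ ((k + a) mod N) ≡⟨ cong toℕ fixed ⟩
      toℕ (a mod N)    ≡⟨ toℕ-mod a ⟩
      a % N            ∎)
    where
    open ≡-Reasoning
    moves : ∀ t → t < N → (k + t) % N ≢ t
    moves t t<N eq with k + t <? N
    ... | yes k+t<N = <⇒≢ 0<k (sym (+-cancelʳ-≡ t k 0 (trans (sym (m<n⇒m%n≡m k+t<N)) eq)))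
    ... | no k+t≮N = <⇒≢ k<N (+-cancelʳ-≡ t k N (begin
        k + t            ≡⟨ m∸n+n≡m N≤k+t ⟨
        k + t ∸ N + N    ≡⟨ cong (_+ N) wrapped ⟩
        t + N            ≡⟨ +-comm t N ⟩
        N + t            ∎))
      where
      N≤k+t : N ≤ k + t
      N≤k+t = ≮⇒≥ k+t≮N
      wrapped : k + t ∸ N ≡ t
      wrapped = begin
        k + t ∸ N            ≡⟨ m<n⇒m%n≡m (+-cancelʳ-< N _ N (subst (_< N + N) (sym (m∸n+n≡m N≤k+t)) (+-mono-< k<N t<N))) ⟨
        (k + t ∸ N) % N      ≡⟨ m≤n⇒[n∸m]%m≡n%m N≤k+t ⟩
        (k + t) % N          ≡⟨ eq ⟩
        t                    ∎

  translate-≢ : ∀ {a b} j → a < b → b < N → (a + j) mod N ≢ (b + j) mod N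
  translate-≢ {a} {b} j a<b b<N eq with m≤n⇒∃[o]m+o≡n a<b
  ... | d , refl = shift-≢ (a + j) z<s (≤-<-trans (s≤s (m≤n+m d a)) b<N)
                     (trans (cong (_mod N) (reassociate a d j)) (sym eq))
    where
    reassociate : ∀ a d j → suc d + (a + j) ≡ suc a + d + j
    reassociate = solve 3 (λ a d j → con 1 :+ d :+ (a :+ j) := con 1 :+ a :+ d :+ j) refl

  translate-injective : ∀ {a b} j → a < N → b < N → (a + j) mod N ≡ (b + j) mod N → a ≡ b
  translate-injective {a} {b} j a<N b<N eq with <-cmp a b
  ... | tri< a<b _ _ = ⊥-elim (translate-≢ j a<b b<N eq)
  ... | tri≈ _ a≡b _ = a≡b
  ... | tri> _ _ b<a = ⊥-elim (translate-≢ j b<a a<N (sym eq))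

deleting-negative-edges-balances : ∀ n' k (σ : Edge (suc n') → Bool) → Balanced n' k σ σ
deleting-negative-edges-balances n' k σ C =
  cong (_% 2) (count-none (σ ∘ edg) (allFin (3 + len)) edg-kept)
  where open Cycle C

module Pentagons (n' : ℕ) where
  open Residues n'

  pentagonEdge : ℕ → Fin 5 → Edge N
  pentagonEdge j fz = rim , j mod N
  pentagonEdge j (fs fz) = rim , suc j mod N
  pentagonEdge j (fs (fs fz)) = spoke , suc (suc j) mod N
  pentagonEdge j (fs (fs (fs fz))) = inn , j mod N
  pentagonEdge j (fs (fs (fs (fs fz)))) = spoke , j mod N

  pentagonCount : (Edge N → Bool) → ℕ → ℕ
  pentagonCount D j = count (D ∘ pentagonEdge j) (allFin 5)

  NegativePentagon : (Edge N → Bool) → ℕ → Set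
  NegativePentagon σ j = pentagonCount σ j % 2 ≡ 1

  edgeAt : (Edge N → Bool) → EKind → ℕ → ℕ
  edgeAt D κ j = bit (D (κ , j mod N))

  R S I : (Edge N → Bool) → ℕ
  R D = sumBelow N (edgeAt D rim)
  S D = sumBelow N (edgeAt D spoke)
  I D = sumBelow N (edgeAt D inn)

  pentagonCount-expand : ∀ D j → pentagonCount D j ≡
    edgeAt D rim j + edgeAt D rim (1 + j) + edgeAt D spoke (2 + j) + edgeAt D inn j + edgeAt D spoke j
  pentagonCount-expand D j =
    count-tabulate 5 id (D ∘ pentagonEdge j) (λ k → bit (D (pentagonEdge j (k mod 5))))
      (λ i → cong (bit ∘ D ∘ pentagonEdge j) (sym (Residues.fin-mod 4 i)))

  card-by-kind : ∀ D → card D ≡ R D + (S D + I D)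
  card-by-kind D = begin
      count D (edges rim ++ (edges spoke ++ (edges inn ++ [])))  ≡⟨ count-++ D (edges rim) _ ⟩
      count D (edges rim) + count D (edges spoke ++ (edges inn ++ []))
        ≡⟨ cong (count D (edges rim) +_) (count-++ D (edges spoke) _) ⟩
      count D (edges rim) + (count D (edges spoke) + count D (edges inn ++ []))
        ≡⟨ cong₂ (λ r s → r + (s + count D (edges inn ++ []))) (of-kind rim) (of-kind spoke) ⟩
      R D + (S D + count D (edges inn ++ []))
        ≡⟨ cong (λ es → R D + (S D + count D es)) (++-identityʳ (edges inn)) ⟩
      R D + (S D + count D (edges inn))
        ≡⟨ cong (λ i → R D + (S D + i)) (of-kind inn) ⟩
      R D + (S D + I D)  ∎
    where
    open ≡-Reasoning
    edges : EKind → List (Edge N)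
    edges κ = map (κ ,_) (allFin N)
    of-kind : ∀ κ → count D (edges κ) ≡ sumBelow N (edgeAt D κ)
    of-kind κ = trans (cong (count D) (map-tabulate id (κ ,_)))
      (count-tabulate N (κ ,_) D (edgeAt D κ) (λ i → cong (λ r → bit (D (κ , r))) (sym (fin-mod i))))

  -- The indicators are N-periodic, so shifting their index leaves the sum over
  -- a full period unchanged.
  edgeAt-rotate₁ : ∀ D κ → sumBelow N (λ j → edgeAt D κ (1 + j)) ≡ sumBelow N (edgeAt D κ)
  edgeAt-rotate₁ D κ = sumBelow-rotate N (edgeAt D κ) (cong (λ r → bit (D (κ , r))) (mod-period 0))

  edgeAt-rotate₂ : ∀ D κ → sumBelow N (λ j → edgeAt D κ (2 + j)) ≡ sumBelow N (edgeAt D κ)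
  edgeAt-rotate₂ D κ = trans
    (sumBelow-rotate N (λ j → edgeAt D κ (1 + j)) (cong (λ r → bit (D (κ , r))) (mod-period 1)))
    (edgeAt-rotate₁ D κ)

  -- Double counting: rim edges and spokes lie on two pentagons, inner edges on one.
  pentagon-double-count : ∀ D → sumBelow N (pentagonCount D) ≡ R D + R D + S D + I D + S D
  pentagon-double-count D = begin
      sumBelow N (pentagonCount D)
        ≡⟨ sumBelow-cong N _ _ (λ j _ → pentagonCount-expand D j) ⟩
      sumBelow N (λ j → r j + r (1 + j) + s (2 + j) + i j + s j)
        ≡⟨ sumBelow-+ N _ s ⟩
      sumBelow N (λ j → r j + r (1 + j) + s (2 + j) + i j) + S D
        ≡⟨ cong (_+ S D) (sumBelow-+ N _ i) ⟩
      sumBelow N (λ j → r j + r (1 + j) + s (2 + j)) + I D + S D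
        ≡⟨ cong (λ x → x + I D + S D) (sumBelow-+ N _ (λ j → s (2 + j))) ⟩
      sumBelow N (λ j → r j + r (1 + j)) + sumBelow N (λ j → s (2 + j)) + I D + S D
        ≡⟨ cong (λ x → x + sumBelow N (λ j → s (2 + j)) + I D + S D) (sumBelow-+ N r (λ j → r (1 + j))) ⟩
      R D + sumBelow N (λ j → r (1 + j)) + sumBelow N (λ j → s (2 + j)) + I D + S D
        ≡⟨ cong₂ (λ x y → R D + x + y + I D + S D) (edgeAt-rotate₁ D rim) (edgeAt-rotate₂ D spoke) ⟩
      R D + R D + S D + I D + S D  ∎
    where
    open ≡-Reasoning
    r s i : ℕ → ℕ
    r = edgeAt D rim
    s = edgeAt D spoke
    i = edgeAt D inn

  -- its vertices u_j, u_{j+1}, u_{j+2}, v_{j+2}, v_j, as (side, offset from j)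
  corner : Fin 5 → Side × Fin 3
  corner fz = outer , fz
  corner (fs fz) = outer , fs fz
  corner (fs (fs fz)) = outer , fs (fs fz)
  corner (fs (fs (fs fz))) = inner , fs (fs fz)
  corner (fs (fs (fs (fs fz)))) = inner , fz

  cornerIndex : Side × Fin 3 → Fin 5
  cornerIndex (outer , fz) = fz
  cornerIndex (outer , fs fz) = fs fz
  cornerIndex (outer , fs (fs fz)) = fs (fs fz)
  cornerIndex (inner , fs (fs fz)) = fs (fs (fs fz))
  cornerIndex (inner , _) = fs (fs (fs (fs fz)))

  cornerIndex-corner : ∀ x → cornerIndex (corner x) ≡ x
  cornerIndex-corner fz = refl
  cornerIndex-corner (fs fz) = refl
  cornerIndex-corner (fs (fs fz)) = refl
  cornerIndex-corner (fs (fs (fs fz))) = refl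
  cornerIndex-corner (fs (fs (fs (fs fz)))) = refl

  pentagonVertex : ℕ → Fin 5 → Vertex N
  pentagonVertex j x = proj₁ (corner x) , (toℕ (proj₂ (corner x)) + j) mod N

  pentagon-joins : ∀ j x → Joins n' 2 (pentagonEdge j x) (pentagonVertex j x) (pentagonVertex j (suc (toℕ x) mod 5))
  pentagon-joins j fz = inj₁ (cong (λ v → (outer , j mod N) , (outer , v)) (shift-mod j 1))
  pentagon-joins j (fs fz) = inj₁ (cong (λ v → (outer , suc j mod N) , (outer , v)) (shift-mod (suc j) 1))
  pentagon-joins j (fs (fs fz)) = inj₁ refl
  pentagon-joins j (fs (fs (fs fz))) = inj₂ (cong (λ v → (inner , j mod N) , (inner , v)) (shift-mod j 2))
  pentagon-joins j (fs (fs (fs (fs fz)))) = inj₂ refl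

  -- For N ≥ 3 the five vertices are distinct, and D-avoiding pentagons are cycles.
  module _ (n'≥2 : 2 ≤ n') where
    pentagonVertex-injective : ∀ j {x y} → pentagonVertex j x ≡ pentagonVertex j y → x ≡ y
    pentagonVertex-injective j {x} {y} same = begin
        x                      ≡⟨ cornerIndex-corner x ⟨
        cornerIndex (corner x) ≡⟨ cong cornerIndex (cong₂ _,_ (cong proj₁ same) same-offset) ⟩
        cornerIndex (corner y) ≡⟨ cornerIndex-corner y ⟩
        y                      ∎
      where
      open ≡-Reasoning
      offset<N : (o : Fin 3) → toℕ o < N
      offset<N o = ≤-trans (toℕ<n o) (s≤s n'≥2)
      same-offset : proj₂ (corner x) ≡ proj₂ (corner y)
      same-offset = toℕ-injective (translate-injective j (offset<N _) (offset<N _) (cong proj₂ same))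

    pentagon : ∀ D j → (∀ x → D (pentagonEdge j x) ≡ false) → Cycle n' 2 D
    pentagon D j avoided = record
      { len = 2
      ; vtx = pentagonVertex j
      ; edg = pentagonEdge j
      ; vtx-injective = pentagonVertex-injective j
      ; edg-joins = pentagon-joins j
      ; edg-kept = avoided
      }

    pentagon-hit : ∀ {σ D} j → Balanced n' 2 σ D → NegativePentagon σ j → 1 ≤ pentagonCount D j
    pentagon-hit {σ} {D} j balanced negative with pentagonCount D j in untouched
    ... | suc _ = s≤s z≤n
    ... | zero = ⊥-elim (0≢1+n (trans (sym (balanced (pentagon D j avoided))) negative))
      where
      avoided : ∀ x → D (pentagonEdge j x) ≡ false
      avoided x = count-zero (D ∘ pentagonEdge j) (allFin 5) untouched (∈-allFin x)

    pentagons-lower-bound : ∀ σ D → (∀ j → j < N → NegativePentagon σ j) → Balanced n' 2 σ D → N ≤ 2 * card D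
    pentagons-lower-bound σ D negative balanced = begin
        N                               ≤⟨ sumBelow-≥ N (pentagonCount D) (λ j j<N → pentagon-hit {σ} j balanced (negative j j<N)) ⟩
        sumBelow N (pentagonCount D)    ≡⟨ pentagon-double-count D ⟩
        R D + R D + S D + I D + S D     ≤⟨ m≤m+n _ (I D) ⟩
        R D + R D + S D + I D + S D + I D ≡⟨ doubled (R D) (S D) (I D) ⟩
        2 * (R D + (S D + I D))         ≡⟨ cong (2 *_) (card-by-kind D) ⟨
        2 * card D                      ∎
      where
      open ≤-Reasoning
      doubled : ∀ r s i → r + r + s + i + s + i ≡ 2 * (r + (s + i))
      doubled = solve 3 (λ r s i → r :+ r :+ s :+ i :+ s :+ i := con 2 :* (r :+ (s :+ i))) refl

odd : ℕ → Bool
odd zero = false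
odd (suc n) = not (odd n)

odd-double : ∀ m → odd (2 * m) ≡ false
odd-double zero = refl
odd-double (suc m) = trans (cong odd (*-suc 2 m)) (cong (not ∘ not) (odd-double m))

sumBelow-odd : ∀ m → sumBelow (2 * m) (bit ∘ odd) ≡ m
sumBelow-odd zero = refl
sumBelow-odd (suc m) = begin
    sumBelow (2 * suc m) (bit ∘ odd)                           ≡⟨ cong (λ n → sumBelow n (bit ∘ odd)) (*-suc 2 m) ⟩
    sumBelow (2 * m) (bit ∘ odd) + bit (odd (2 * m)) + bit (not (odd (2 * m)))
      ≡⟨ +-assoc (sumBelow (2 * m) (bit ∘ odd)) _ _ ⟩
    sumBelow (2 * m) (bit ∘ odd) + (bit (odd (2 * m)) + bit (not (odd (2 * m))))
      ≡⟨ cong₂ _+_ (sumBelow-odd m) (bit-not (odd (2 * m))) ⟩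
    m + 1                                                       ≡⟨ +-comm m 1 ⟩
    suc m                                                       ∎
  where open ≡-Reasoning

sumBelow-point : ∀ n → sumBelow (suc n) (λ j → bit (j ≡ᵇ n)) ≡ 1
sumBelow-point n = cong₂ _+_
  (trans (sumBelow-cong n _ _ (λ j j<n → bit-¬T (<⇒≢ j<n ∘ ≡ᵇ⇒≡ j n))) (sumBelow-zero n))
  (bit-T (≡⇒≡ᵇ n n refl))

module OddRimSignature (m : ℕ) where
  open Residues (2 * m)
  open Pentagons (2 * m)

  σ : Edge N → Bool
  σ (rim , i) = odd (toℕ i)
  σ (spoke , i) = false
  σ (inn , i) = toℕ i ≡ᵇ 2 * m

  rim-below : ∀ {j} → j < N → edgeAt σ rim j ≡ bit (odd j)
  rim-below j<N = cong (bit ∘ odd) (toℕ-mod-below j<N)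

  σ-card : card σ ≡ m + 1
  σ-card = begin
      card σ                 ≡⟨ card-by-kind σ ⟩
      R σ + (S σ + I σ)      ≡⟨ cong₂ (λ r i → r + (S σ + i)) rims inners ⟩
      m + (S σ + 1)          ≡⟨ cong (λ s → m + (s + 1)) (sumBelow-zero N) ⟩
      m + 1                  ∎
    where
    open ≡-Reasoning
    rims : R σ ≡ m
    rims = begin
      R σ                           ≡⟨ sumBelow-cong N _ (bit ∘ odd) (λ j → rim-below) ⟩
      sumBelow N (bit ∘ odd)        ≡⟨ cong₂ _+_ (sumBelow-odd m) (cong bit (odd-double m)) ⟩
      m + 0                         ≡⟨ +-identityʳ m ⟩
      m                             ∎
    inners : I σ ≡ 1
    inners = trans (sumBelow-cong N _ _ (λ j j<N → cong (λ t → bit (t ≡ᵇ 2 * m)) (toℕ-mod-below j<N)))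
                   (sumBelow-point (2 * m))

  inner-off : ∀ {j} → j < 2 * m → edgeAt σ inn j ≡ 0
  inner-off {j} j<2m = trans (cong (λ t → bit (t ≡ᵇ 2 * m)) (toℕ-mod-below (m<n⇒m<1+n j<2m)))
                             (bit-¬T (<⇒≢ j<2m ∘ ≡ᵇ⇒≡ j (2 * m)))

  -- Each pentagon contains exactly one negative edge: one of the two rim
  -- edges u_j u_{j+1}, u_{j+1} u_{j+2} when j < 2m, the inner edge v_{2m} v_1 when j = 2m.
  σ-pentagon-count : ∀ j → j < N → pentagonCount σ j ≡ 1
  σ-pentagon-count j j<N with m≤n⇒m<n∨m≡n (≤-pred j<N)
  ... | inj₁ j<2m = begin
      pentagonCount σ j                                  ≡⟨ pentagonCount-expand σ j ⟩
      edgeAt σ rim j + edgeAt σ rim (1 + j) + 0 + edgeAt σ inn j + 0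
        ≡⟨ cong₂ (λ a b → a + b + 0 + edgeAt σ inn j + 0) (rim-below j<N) (rim-below (s≤s j<2m)) ⟩
      bit (odd j) + bit (not (odd j)) + 0 + edgeAt σ inn j + 0
        ≡⟨ cong₂ (λ a c → a + 0 + c + 0) (bit-not (odd j)) (inner-off j<2m) ⟩
      1                                                  ∎
    where open ≡-Reasoning
  ... | inj₂ refl = begin
      pentagonCount σ (2 * m)                            ≡⟨ pentagonCount-expand σ (2 * m) ⟩
      edgeAt σ rim (2 * m) + edgeAt σ rim N + 0 + edgeAt σ inn (2 * m) + 0
        ≡⟨ cong₂ (λ a b → a + b + 0 + edgeAt σ inn (2 * m) + 0) last-rim wrapped-rim ⟩
      edgeAt σ inn (2 * m) + 0
        ≡⟨ cong (λ t → bit (t ≡ᵇ 2 * m) + 0) (toℕ-mod-below j<N) ⟩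
      bit (2 * m ≡ᵇ 2 * m) + 0                           ≡⟨ cong (_+ 0) (bit-T (≡⇒≡ᵇ (2 * m) (2 * m) refl)) ⟩
      1                                                  ∎
    where
    open ≡-Reasoning
    last-rim : edgeAt σ rim (2 * m) ≡ 0
    last-rim = trans (rim-below j<N) (cong bit (odd-double m))
    wrapped-rim : edgeAt σ rim N ≡ 0
    wrapped-rim = cong (bit ∘ odd) (trans (toℕ-mod N) (n%n≡0 N))

  σ-pentagons-negative : ∀ j → j < N → NegativePentagon σ j
  σ-pentagons-negative j j<N = cong (_% 2) (σ-pentagon-count j j<N)

lemma3p6 : (m : ℕ) → 2 ≤ m →
    Σ (Edge (suc (2 * m)) → Bool) λ σ → FrustrationIndexIs (2 * m) 2 σ (m + 1)
lemma3p6 m m≥2 = σ , (σ , σ-card , deleting-negative-edges-balances (2 * m) 2 σ) , at-least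
  where
  open OddRimSignature m
  open Pentagons (2 * m) using (pentagons-lower-bound)

  2m≥2 : 2 ≤ 2 * m
  2m≥2 = ≤-trans m≥2 (m≤m+n m (m + 0))

  at-least : ∀ D → Balanced (2 * m) 2 σ D → m + 1 ≤ card D
  at-least D balanced = subst (_≤ card D) (+-comm 1 m)
    (*-cancelˡ-< 2 m (card D) (pentagons-lower-bound 2m≥2 σ D σ-pentagons-negative balanced))
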